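{- Let $S_2$ be a primitive non-powerful signed digraph of order $n$ whose underlying digraph is $D_2$, and let $1\le k\le n$. (1) If the two cycles of length $n-1$ of $S_2$ have different signs, then $L(S_2,k) \le (n-k+1)(n-1)+2$. (2) If the two cycles of length $n-1$ of $S_2$ have the same sign, then $L(S_2,k) = (2n-k)(n-1)$.
   Context: A signed digraph $S$ is a digraph (loops allowed, no multiple arcs) on a finite vertex set in which each arc is assigned a sign $1$ or $-1$; its underlying digraph is obtained by forgetting the signs, and its order is its number of vertices. A walk of length $m$ is a sequence of arcs $e_1,\dots,e_m$ such that the terminal vertex of $e_i$ is the initial vertex of $e_{i+1}$; for each vertex $u$ there is also the trivial walk of length $0$ from $u$ to $u$. The sign of a walk (or cycle) is the product of the signs of its arcs (the trivial walk has sign $1$). Two walks form a pair of SSSD walks if they have the same initial vertex, the same terminal vertex, the same length, but different signs. A digraph $D$ is primitive if there is a positive integer $m$ such that for every ordered pair $(u,v)$ of vertices there is a walk of length $m$ from $u$ to $v$; a signed digraph is primitive if its underlying digraph is. A signed digraph is non-powerful if it contains a pair of SSSD walks. For a primitive non-powerful signed digraph $S$ and $X \subseteq V(S)$, $l_S(X)$ is the least integer $p\ge 0$ such that for every vertex $v$ of $S$ there exist $x\in X$ and a pair of SSSD walks of length $p$ from $x$ to $v$; the $k$th upper base is $L(S,k)=\max\{l_S(X) : X\subseteq V(S),\ |X|=k\}$. $D_2$ is the digraph with vertex set $\{1,\dots,n\}$ and arcs $(i,i+1)$ for $1\le i\le n-1$, $(n,1)$, $(n-1,1)$ and $(n,2)$.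 Its only cycles of length $n-1$ are $1\to2\to\cdots\to n-1\to1$ and $2\to3\to\cdots\to n\to2$. -}

module Defs where

open import Data.Nat using (ℕ; zero; suc; _∸_; _<_; _≤_; _≤?_; _<?_)
open import Data.Fin using (Fin; toℕ)
open import Data.Fin.Subset using (Subset; _∈_)
open import Data.List using (List; []; _∷_; _++_; filter; allFin)
open import Data.Maybe using (Maybe; just; nothing; Is-just)
open import Data.Product using (Σ; _×_; ∃; ∃-syntax)
open import Data.Sum using (_⊎_)
open import Relation.Binary.PropositionalEquality using (_≡_; _≢_)
open import Relation.Nullary using (¬_)
open import Function.Bundles using (_⇔_)

data Sign : Set where
  pos neg : Sign

_·_ : Sign → Sign → Sign
pos · s = s
neg · pos = neg
neg · neg = pos

-- A signed digraph on the vertex set Fin n (loops allowed, no multiple arcs):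
-- sgn u v = nothing if there is no arc u → v, and just s if there is an arc of sign s.
SignedDigraph : ℕ → Set
SignedDigraph n = Fin n → Fin n → Maybe Sign

Digraph : ℕ → Set₁
Digraph n = Fin n → Fin n → Set

Underlying : ∀ {n} → SignedDigraph n → Digraph n
Underlying S u v = Is-just (S u v)

-- The digraph D_2 of order n.  Vertex i : Fin n is the paper's vertex toℕ i + 1.
-- Arcs (a, a+1) for 1 ≤ a ≤ n-1, (n,1), (n-1,1), (n,2).
D₂ : (n : ℕ) → Digraph n
D₂ n i j =
  (b ≡ suc a)
  ⊎ ((a ≡ n × b ≡ 1) ⊎ ((a ≡ n ∸ 1 × b ≡ 1) ⊎ (a ≡ n × b ≡ 2)))
  where
  a = suc (toℕ i)
  b = suc (toℕ j)

SameDigraph : ∀ {n} → Digraph n → Digraph n → Set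
SameDigraph D E = ∀ u v → D u v ⇔ E u v

data Walk {n} (S : SignedDigraph n) : Fin n → Fin n → ℕ → Set where
  []  : ∀ {u} → Walk S u u 0
  _∷_ : ∀ {u w v m} {s : Sign} → S u w ≡ just s → Walk S w v m → Walk S u v (suc m)

walkSign : ∀ {n} {S : SignedDigraph n} {u v m} → Walk S u v m → Sign
walkSign [] = pos
walkSign (_∷_ {s = s} _ p) = s · walkSign p

Primitive : ∀ {n} → SignedDigraph n → Set
Primitive {n} S = Σ ℕ λ m → (1 ≤ m) × (∀ (u v : Fin n) → Walk S u v m)

SSSD : ∀ {n} → SignedDigraph n → Fin n → Fin n → ℕ → Set
SSSD S u v m = Σ (Walk S u v m) λ p → Σ (Walk S u v m) λ q → walkSign p ≢ walkSign q

NonPowerful : ∀ {n} → SignedDigraph n → Set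
NonPowerful {n} S = Σ (Fin n) λ u → Σ (Fin n) λ v → Σ ℕ λ m → SSSD S u v m

Covers : ∀ {n} → SignedDigraph n → Subset n → ℕ → Set
Covers {n} S X p = ∀ (v : Fin n) → Σ (Fin n) λ x → (x ∈ X) × SSSD S x v p

-- l_S(X) = p  (p is the least integer with Covers S X p).
IsLocalBase : ∀ {n} → SignedDigraph n → Subset n → ℕ → Set
IsLocalBase S X p = Covers S X p × (∀ q → q < p → ¬ Covers S X q)

-- L(S,k) = b  (b is the maximum of l_S(X) over X with |X| = k).
IsUpperBase : ∀ {n} → SignedDigraph n → ℕ → ℕ → Set
IsUpperBase {n} S k b =
  (Σ (Subset n) λ X → (Data.Fin.Subset.∣ X ∣ ≡ k) × IsLocalBase S X b)
  × (∀ (X : Subset n) → Data.Fin.Subset.∣ X ∣ ≡ k → ∀ p → IsLocalBase S X p → p ≤ b)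

pathSign : ∀ {n} → SignedDigraph n → List (Fin n) → Maybe Sign
pathSign S [] = just pos
pathSign S (u ∷ []) = just pos
pathSign S (u ∷ w ∷ vs) with S u w | pathSign S (w ∷ vs)
... | just s | just t = just (s · t)
... | _      | _      = nothing

cycleSign : ∀ {n} → SignedDigraph n → List (Fin n) → Maybe Sign
cycleSign S [] = just pos
cycleSign S (v ∷ vs) = pathSign S ((v ∷ vs) ++ (v ∷ []))

-- The two cycles of length n-1 of D_2:
-- C₁ = 1 → 2 → ... → n-1 → 1   and   C₂ = 2 → 3 → ... → n → 2.
C₁ : (n : ℕ) → List (Fin n)
C₁ n = filter (λ v → suc (toℕ v) ≤? n ∸ 1) (allFin n)

C₂ : (n : ℕ) → List (Fin n)
C₂ n = filter (λ v → 2 ≤? suc (toℕ v)) (allFin n)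

-- Switching S by the running product θ of the forward-arc signs makes every arc i → i + 1
-- positive without changing cycle signs or which pairs of walks are SSSD.  What remains are
-- the arcs A = (n,1), B = (n-1,1), C = (n,2), whose signs a, b, c are the signs of the
-- n-cycle and of the two (n-1)-cycles, and a walk u → v of length l through α, β, γ of them
-- satisfies l + u = v + αn + (β + γ)(n - 1) and has sign aᵅbᵝcᵞ.
-- If b ≠ c, trading one B-cycle for one C-cycle yields SSSD pairs.  If b = c, two such
-- walks of equal length differ by multiples of (n - 1 A-cycles against n B-cycles), as n - 1
-- and n are coprime; so non-powerfulness forces a^(n-1) ≠ bⁿ, every SSSD pair uses at least
-- n short cycles, and X = {1} ∪ {n - k + 2, …, n} attains (2n - k)(n - 1).  The upper bounds
-- are a pigeonhole argument: among k starting vertices one avoids the k - 1 residues of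
-- x - v (mod n) for which no pair of the required length exists.

module Submission where

open import Defs
open import Data.Nat using (ℕ; zero; suc; NonZero; _≤?_; _+_; _*_; _∸_; _≤_; _<_; z≤n; s≤s; s≤s⁻¹; _≟_)
open import Data.Nat.Properties
open import Relation.Binary.Definitions using (tri<; tri≈; tri>)
open import Data.Fin as Fin using (Fin; toℕ)
open import Data.Fin.Properties using (any?; all?; toℕ-fromℕ<; toℕ-injective; toℕ<n)
open import Data.Nat.DivMod using (_mod_; _%_; _/_; m≡m%n+[m/n]*n; m%n<n; m<n⇒m%n≡m; [m+kn]%n≡m%n)
open import Data.Fin.Subset using (Subset; _∈_; _∉_; inside; outside; ∣_∣; ⁅_⁆; _-_; Nonempty)
open import Data.Fin.Subset.Properties using (_∈?_; p─q⊆p; p─⊥≡p)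
open import Data.Vec using ([]; _∷_; here; there)
open import Data.List using (List; []; _∷_; _++_; filter; tabulate; allFin)
open import Data.List.Properties using (filter-all; filter-reject; filter-++; ++-identityʳ)
open import Data.List.Relation.Unary.All using (All; []; _∷_)
open import Data.Maybe using (Maybe; just; nothing; Is-just; fromMaybe)
import Data.Maybe as Maybe
open import Data.Maybe.Relation.Unary.Any using (just)
open import Data.Maybe.Properties using (just-injective)
open import Data.Unit using (tt)
open import Data.Product using (Σ; ∃; _×_; _,_; proj₁; proj₂)
open import Data.Sum using (_⊎_; inj₁; inj₂)
open import Relation.Nullary using (¬_; Dec; yes; no; contradiction)
open import Relation.Nullary.Decidable using (map′; _×-dec_)
open import Relation.Unary using (Decidable)
open import Relation.Binary.PropositionalEquality
open import Function.Bundles using (_⇔_; mk⇔; Equivalence)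
open import Function using (_∘_; id)
open import Data.Nat.Tactic.RingSolver using (solve-∀)

sign? : (s t : Sign) → Dec (s ≡ t)
sign? pos pos = yes refl
sign? pos neg = no λ ()
sign? neg pos = no λ ()
sign? neg neg = yes refl

·-identityʳ : ∀ s → s · pos ≡ s
·-identityʳ pos = refl
·-identityʳ neg = refl

·-assoc : ∀ r s t → (r · s) · t ≡ r · (s · t)
·-assoc pos s t = refl
·-assoc neg pos t = refl
·-assoc neg neg pos = refl
·-assoc neg neg neg = refl

·-comm : ∀ s t → s · t ≡ t · s
·-comm pos pos = refl
·-comm pos neg = refl
·-comm neg pos = refl
·-comm neg neg = refl

·-selfInverse : ∀ s → s · s ≡ pos
·-selfInverse pos = refl
·-selfInverse neg = refl

·-involutiveˡ : ∀ r s → r · (r · s) ≡ s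
·-involutiveˡ r s = trans (sym (·-assoc r r s)) (cong (_· s) (·-selfInverse r))

·-cancelˡ : ∀ r {s t} → r · s ≡ r · t → s ≡ t
·-cancelˡ r {s} {t} e = trans (sym (·-involutiveˡ r s)) (trans (cong (r ·_) e) (·-involutiveˡ r t))

·-cancelʳ : ∀ r {s t} → s · r ≡ t · r → s ≡ t
·-cancelʳ r {s} {t} e = ·-cancelˡ r (trans (·-comm r s) (trans e (·-comm t r)))

·-exchange : ∀ r s t → r · (s · t) ≡ s · (r · t)
·-exchange r s t = trans (sym (·-assoc r s t)) (trans (cong (_· t) (·-comm r s)) (·-assoc s r t))

·-telescope : ∀ r s t u v → (r · (s · t)) · (t · (u · v)) ≡ r · ((s · u) · v)
·-telescope r s t u v = begin
  (r · (s · t)) · (t · (u · v))  ≡⟨ ·-assoc r (s · t) _ ⟩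
  r · ((s · t) · (t · (u · v)))  ≡⟨ cong (r ·_) (·-assoc s t _) ⟩
  r · (s · (t · (t · (u · v))))  ≡⟨ cong (λ x → r · (s · x)) (·-involutiveˡ t (u · v)) ⟩
  r · (s · (u · v))              ≡⟨ cong (r ·_) (·-assoc s u v) ⟨
  r · ((s · u) · v)              ∎
  where open ≡-Reasoning

infixr 30 _^_

_^_ : Sign → ℕ → Sign
s ^ zero = pos
s ^ suc k = s · s ^ k

^-+ : ∀ s i j → s ^ (i + j) ≡ s ^ i · s ^ j
^-+ s zero j = refl
^-+ s (suc i) j = trans (cong (s ·_) (^-+ s i j)) (sym (·-assoc s (s ^ i) (s ^ j)))

^-* : ∀ s t i → s ^ (t * i) ≡ (s ^ i) ^ t
^-* s zero i = refl
^-* s (suc t) i = trans (^-+ s i (t * i)) (cong (s ^ i ·_) (^-* s t i))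

SignedWalk : ∀ {n} → SignedDigraph n → Fin n → Fin n → ℕ → Sign → Set
SignedWalk S u v l s = Σ (Walk S u v l) λ p → walkSign p ≡ s

module _ {n} {S : SignedDigraph n} where

  _++ʷ_ : ∀ {u w v i j} → Walk S u w i → Walk S w v j → Walk S u v (i + j)
  [] ++ʷ q = q
  (e ∷ p) ++ʷ q = e ∷ (p ++ʷ q)

  walkSign-++ʷ : ∀ {u w v i j} (p : Walk S u w i) (q : Walk S w v j) →
                 walkSign (p ++ʷ q) ≡ walkSign p · walkSign q
  walkSign-++ʷ [] q = refl
  walkSign-++ʷ (_∷_ {s = s} e p) q =
    trans (cong (s ·_) (walkSign-++ʷ p q)) (sym (·-assoc s (walkSign p) (walkSign q)))

  signedWalk? : ∀ u v l s → Dec (SignedWalk S u v l s)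
  signedWalk? u v zero s with u Fin.≟ v | sign? pos s
  ... | yes refl | yes refl = yes ([] , refl)
  ... | no u≢v   | _        = no λ { ([] , _) → u≢v refl }
  ... | yes refl | no pos≢s = no λ { ([] , e) → pos≢s e }
  signedWalk? u v (suc l) s = map′ join split (any? firstArc?)
    where
    FirstArc : Fin n → Set
    FirstArc w = Σ Sign λ t → (S u w ≡ just t) × SignedWalk S w v l (t · s)
    firstArc? : ∀ w → Dec (FirstArc w)
    firstArc? w with S u w in e
    ... | nothing = no λ { (_ , () , _) }
    ... | just t with signedWalk? w v l (t · s)
    ...   | yes q = yes (t , refl , q)
    ...   | no ¬q = no λ { (.t , refl , q) → ¬q q }
    join : ∃ FirstArc → SignedWalk S u v (suc l) s
    join (w , t , e , p , ps) = (e ∷ p) , trans (cong (t ·_) ps) (·-involutiveˡ t s)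
    split : SignedWalk S u v (suc l) s → ∃ FirstArc
    split (_∷_ {w = w} {s = t} e p , ps) =
      w , t , e , p , trans (sym (·-involutiveˡ t (walkSign p))) (cong (t ·_) ps)

  SSSD⇔walks : ∀ {u v l} → SSSD S u v l ⇔ (SignedWalk S u v l pos × SignedWalk S u v l neg)
  SSSD⇔walks = mk⇔ to from
    where
    to : ∀ {u v l} → SSSD S u v l → SignedWalk S u v l pos × SignedWalk S u v l neg
    to (p , q , ≢) with walkSign p in ep | walkSign q in eq
    ... | pos | pos = contradiction refl ≢
    ... | pos | neg = (p , ep) , (q , eq)
    ... | neg | pos = (q , eq) , (p , ep)
    ... | neg | neg = contradiction refl ≢
    from : ∀ {u v l} → SignedWalk S u v l pos × SignedWalk S u v l neg → SSSD S u v l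
    from ((p , ep) , (q , eq)) = p , q , λ e → pos≢neg (trans (sym ep) (trans e eq))
      where
      pos≢neg : pos ≢ neg
      pos≢neg ()

  sssd? : ∀ u v l → Dec (SSSD S u v l)
  sssd? u v l = map′ (Equivalence.from SSSD⇔walks) (Equivalence.to SSSD⇔walks)
                     (signedWalk? u v l pos ×-dec signedWalk? u v l neg)

  covers? : ∀ X p → Dec (Covers S X p)
  covers? X p = all? λ v → any? λ x → (x ∈? X) ×-dec sssd? x v p

IsLeast : (ℕ → Set) → ℕ → Set
IsLeast P p = P p × (∀ q → q < p → ¬ P q)

IsLeast-unique : ∀ {P p q} → IsLeast P p → IsLeast P q → p ≡ q
IsLeast-unique {p = p} {q} (Pp , p-least) (Pq , q-least) =
  ≤-antisym (≮⇒≥ λ q<p → p-least q q<p Pq) (≮⇒≥ λ p<q → q-least p p<q Pp)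

IsLeast-≤ : ∀ {P p q} → IsLeast P p → P q → p ≤ q
IsLeast-≤ (_ , p-least) Pq = ≮⇒≥ λ q<p → p-least _ q<p Pq

module _ {P : ℕ → Set} (P? : Decidable P) where

  -- μ B is the least p ≤ B with P p, and B itself if there is none.
  μ : ℕ → ℕ
  μ zero = zero
  μ (suc B) with anyUpTo? P? (suc B)
  ... | yes _ = μ B
  ... | no _  = suc B

  μ-least : ∀ {p} B → P p → p ≤ B → IsLeast P (μ B)
  μ-least zero Pp z≤n = Pp , λ _ ()
  μ-least (suc B) Pp p≤1+B with anyUpTo? P? (suc B)
  ... | yes (q , q<1+B , Pq) = μ-least B Pq (s≤s⁻¹ q<1+B)
  ... | no ¬earlier with m≤n⇒m<n∨m≡n p≤1+B
  ...   | inj₁ p<1+B = contradiction (_ , p<1+B , Pp) ¬earlier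
  ...   | inj₂ refl  = Pp , λ q q<p Pq → ¬earlier (q , q<p , Pq)

Maximises : ∀ {n} → (Subset n → Set) → (Subset n → ℕ) → Subset n → Set
Maximises Q g X = Q X × (∀ Y → Q Y → g Y ≤ g X)

maximum-or-empty : ∀ {n} {Q : Subset n → Set} → Decidable Q → (g : Subset n → ℕ) →
                   ∃ (Maximises Q g) ⊎ (∀ Y → ¬ Q Y)
maximum-or-empty {zero} Q? g with Q? []
... | yes q = inj₁ ([] , q , λ { [] _ → ≤-refl })
... | no ¬q = inj₂ λ { [] → ¬q }
maximum-or-empty {suc n} {Q} Q? g
  with maximum-or-empty (λ Y → Q? (outside ∷ Y)) (λ Y → g (outside ∷ Y))
     | maximum-or-empty (λ Y → Q? (inside ∷ Y))  (λ Y → g (inside ∷ Y))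
... | inj₂ ¬out | inj₂ ¬in = inj₂ λ { (outside ∷ Y) → ¬out Y ; (inside ∷ Y) → ¬in Y }
... | inj₁ (X , qX , maxX) | inj₂ ¬in =
  inj₁ (outside ∷ X , qX , λ { (outside ∷ Y) qY → maxX Y qY ; (inside ∷ Y) qY → contradiction qY (¬in Y) })
... | inj₂ ¬out | inj₁ (X , qX , maxX) =
  inj₁ (inside ∷ X , qX , λ { (outside ∷ Y) qY → contradiction qY (¬out Y) ; (inside ∷ Y) qY → maxX Y qY })
... | inj₁ (X₀ , qX₀ , maxX₀) | inj₁ (X₁ , qX₁ , maxX₁) with g (outside ∷ X₀) ≤? g (inside ∷ X₁)
...   | yes ≤₁ = inj₁ (inside ∷ X₁ , qX₁ , λ { (outside ∷ Y) qY → ≤-trans (maxX₀ Y qY) ≤₁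
                                            ; (inside ∷ Y) qY → maxX₁ Y qY })
...   | no ≰₁  = inj₁ (outside ∷ X₀ , qX₀ , λ { (outside ∷ Y) qY → maxX₀ Y qY
                                             ; (inside ∷ Y) qY → ≤-trans (maxX₁ Y qY) (<⇒≤ (≰⇒> ≰₁)) })

module _ {n} (S : SignedDigraph n) (B : ℕ) where

  localBase≤ : Subset n → ℕ
  localBase≤ X = μ (covers? {S = S} X) B

  upperBase-≤ : ∀ k → (∃ λ X → ∣ X ∣ ≡ k) → (∀ X → ∣ X ∣ ≡ k → Covers S X B) →
                Σ ℕ λ b → IsUpperBase S k b × b ≤ B
  upperBase-≤ k (X₀ , ∣X₀∣) covered with maximum-or-empty (λ X → ∣ X ∣ ≟ k) localBase≤
  ... | inj₂ none = contradiction ∣X₀∣ (none X₀)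
  ... | inj₁ (X , ∣X∣ , maximal) =
    localBase≤ X , ((X , ∣X∣ , isLocalBase X ∣X∣) , bounded) ,
    IsLeast-≤ (isLocalBase X ∣X∣) (covered X ∣X∣)
    where
    isLocalBase : ∀ Y → ∣ Y ∣ ≡ k → IsLocalBase S Y (localBase≤ Y)
    isLocalBase Y ∣Y∣ = μ-least (covers? {S = S} Y) B (covered Y ∣Y∣) ≤-refl
    bounded : ∀ Y → ∣ Y ∣ ≡ k → ∀ p → IsLocalBase S Y p → p ≤ localBase≤ X
    bounded Y ∣Y∣ p lb = subst (_≤ localBase≤ X) (IsLeast-unique (isLocalBase Y ∣Y∣) lb) (maximal Y ∣Y∣)

IsUpperBase-attained : ∀ {n} (S : SignedDigraph n) k B →
                       (Σ (Subset n) λ X → ∣ X ∣ ≡ k × IsLocalBase S X B) →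
                       (∀ X → ∣ X ∣ ≡ k → Covers S X B) → IsUpperBase S k B
IsUpperBase-attained S k B attained covered = attained , λ Y ∣Y∣ p lb → IsLeast-≤ lb (covered Y ∣Y∣)

∣p∣≤1+∣p-x∣ : ∀ {n} (p : Subset n) x → ∣ p ∣ ≤ suc ∣ p - x ∣
∣p∣≤1+∣p-x∣ (outside ∷ p) Fin.zero = ≤-trans (≤-reflexive (cong ∣_∣ (sym (p─⊥≡p p)))) (n≤1+n _)
∣p∣≤1+∣p-x∣ (inside ∷ p) Fin.zero = s≤s (≤-reflexive (cong ∣_∣ (sym (p─⊥≡p p))))
∣p∣≤1+∣p-x∣ (outside ∷ p) (Fin.suc x) = ∣p∣≤1+∣p-x∣ p x
∣p∣≤1+∣p-x∣ (inside ∷ p) (Fin.suc x) = s≤s (∣p∣≤1+∣p-x∣ p x)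

x∉p-x : ∀ {n} (p : Subset n) x → x ∉ p - x
x∉p-x (_ ∷ p) Fin.zero ()
x∉p-x (_ ∷ p) (Fin.suc x) (there x∈) = x∉p-x p x x∈

nonempty : ∀ {n} (p : Subset n) → 0 < ∣ p ∣ → Nonempty p
nonempty (inside ∷ p) _ = Fin.zero , here
nonempty (outside ∷ p) 0<∣p∣ with nonempty p 0<∣p∣
... | x , x∈p = Fin.suc x , there x∈p

pigeonhole : ∀ {n} (X : Subset n) (f : ℕ → Fin n) k → k < ∣ X ∣ →
             ∃ λ x → x ∈ X × (∀ t → t < k → x ≢ f t)
pigeonhole X f zero 0<∣X∣ with nonempty X 0<∣X∣
... | x , x∈X = x , x∈X , λ _ ()
pigeonhole X f (suc k) k<∣X∣ with pigeonhole (X - f k) f k (s≤s⁻¹ (≤-trans k<∣X∣ (∣p∣≤1+∣p-x∣ X (f k))))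
... | x , x∈X-fk , avoids = x , p─q⊆p X ⁅ f k ⁆ x∈X-fk , avoids′
  where
  avoids′ : ∀ t → t < suc k → x ≢ f t
  avoids′ t t<1+k with m≤n⇒m<n∨m≡n (s≤s⁻¹ t<1+k)
  ... | inj₁ t<k = avoids t t<k
  ... | inj₂ refl = λ { refl → x∉p-x X x x∈X-fk }

atLeast : ∀ {n} → ℕ → Subset n
atLeast {zero} _ = []
atLeast {suc n} zero = inside ∷ atLeast zero
atLeast {suc n} (suc c) = outside ∷ atLeast c

∣atLeast∣ : ∀ n c → ∣ atLeast {n} c ∣ ≡ n ∸ c
∣atLeast∣ zero zero = refl
∣atLeast∣ zero (suc c) = refl
∣atLeast∣ (suc n) zero = cong suc (∣atLeast∣ n zero)
∣atLeast∣ (suc n) (suc c) = ∣atLeast∣ n c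

∈atLeast⇒≤ : ∀ {n} c {j : Fin n} → j ∈ atLeast c → c ≤ toℕ j
∈atLeast⇒≤ zero _ = z≤n
∈atLeast⇒≤ (suc c) {Fin.suc j} (there j∈) = s≤s (∈atLeast⇒≤ c j∈)

-- Switching

Is-just⇒≡just : ∀ {x : Maybe Sign} → Is-just x → ∃ λ s → x ≡ just s
Is-just⇒≡just (just {x = s} _) = s , refl

switch : ∀ {n} → (Fin n → Sign) → SignedDigraph n → SignedDigraph n
switch θ S u v = Maybe.map (λ s → θ u · (s · θ v)) (S u v)

module _ {n} (θ : Fin n → Sign) (S : SignedDigraph n) where

  switch-walk : ∀ {u v l} (p : Walk S u v l) → SignedWalk (switch θ S) u v l (θ u · (walkSign p · θ v))
  switch-walk {u} [] = [] , sym (·-selfInverse (θ u))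
  switch-walk {u} {v} (_∷_ {w = w} {s = s} e p) with switch-walk p
  ... | q , q-sign = (cong (Maybe.map _) e ∷ q) ,
                     trans (cong ((θ u · (s · θ w)) ·_) q-sign)
                           (·-telescope (θ u) s (θ w) (walkSign p) (θ v))

  switch-involutive : ∀ u v → switch θ (switch θ S) u v ≡ S u v
  switch-involutive u v with S u v
  ... | nothing = refl
  ... | just s = cong just (trans (cong (θ u ·_) (·-assoc (θ u) (s · θ v) (θ v)))
                          (trans (·-involutiveˡ (θ u) _)
                          (trans (·-assoc s (θ v) (θ v))
                          (trans (cong (s ·_) (·-selfInverse (θ v))) (·-identityʳ s)))))

  switch-underlying : SameDigraph (Underlying (switch θ S)) (Underlying S)
  switch-underlying u v with S u v
  ... | nothing = mk⇔ (λ ()) (λ ())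
  ... | just _  = mk⇔ (λ _ → just tt) (λ _ → just tt)

  sssd-switch : ∀ {u v l} → SSSD S u v l → SSSD (switch θ S) u v l
  sssd-switch {u} {v} (p , q , signs≢) with switch-walk p | switch-walk q
  ... | p′ , p′-sign | q′ , q′-sign =
    p′ , q′ , λ e → signs≢ (·-cancelʳ (θ v) (·-cancelˡ (θ u) (trans (sym p′-sign) (trans e q′-sign))))

  nonPowerful-switch : NonPowerful S → NonPowerful (switch θ S)
  nonPowerful-switch (u , v , l , pair) = u , v , l , sssd-switch pair

  pathSign-switch : ∀ u vs z →
    pathSign (switch θ S) (u ∷ vs ++ z ∷ [])
      ≡ Maybe.map (λ s → θ u · (s · θ z)) (pathSign S (u ∷ vs ++ z ∷ []))
  pathSign-switch u [] z with S u z
  ... | nothing = refl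
  ... | just s = cong just (trans (·-identityʳ _) (cong (λ x → θ u · (x · θ z)) (sym (·-identityʳ s))))
  pathSign-switch u (w ∷ vs) z rewrite pathSign-switch w vs z with S u w | pathSign S (w ∷ vs ++ z ∷ [])
  ... | nothing | _ = refl
  ... | just s | nothing = refl
  ... | just s | just t = cong just (·-telescope (θ u) s (θ w) t (θ z))

  cycleSign-switch : ∀ L → cycleSign (switch θ S) L ≡ cycleSign S L
  cycleSign-switch [] = refl
  cycleSign-switch (v ∷ vs) rewrite pathSign-switch v vs v with pathSign S (v ∷ vs ++ v ∷ [])
  ... | nothing = refl
  ... | just s = cong just (trans (cong (θ v ·_) (·-comm s (θ v))) (·-involutiveˡ (θ v) s))

walk-cong : ∀ {n} {S S′ : SignedDigraph n} → (∀ u v → S u v ≡ S′ u v) →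
            ∀ {u v l} (p : Walk S u v l) → SignedWalk S′ u v l (walkSign p)
walk-cong S≗S′ [] = [] , refl
walk-cong S≗S′ (_∷_ {s = s} e p) with walk-cong S≗S′ p
... | p′ , p′-sign = (trans (sym (S≗S′ _ _)) e ∷ p′) , cong (s ·_) p′-sign

sssd-cong : ∀ {n} {S S′ : SignedDigraph n} → (∀ u v → S u v ≡ S′ u v) →
            ∀ {u v l} → SSSD S u v l → SSSD S′ u v l
sssd-cong S≗S′ (p , q , signs≢) with walk-cong S≗S′ p | walk-cong S≗S′ q
... | p′ , p′-sign | q′ , q′-sign = p′ , q′ , λ e → signs≢ (trans (sym p′-sign) (trans e q′-sign))

module _ {n} (θ : Fin n → Sign) (S : SignedDigraph n) where

  sssd-unswitch : ∀ {u v l} → SSSD (switch θ S) u v l → SSSD S u v l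
  sssd-unswitch = sssd-cong (switch-involutive θ S) ∘ sssd-switch θ (switch θ S)

  covers-switch : ∀ X p → Covers S X p ⇔ Covers (switch θ S) X p
  covers-switch X p = mk⇔ (λ cov v → transfer (sssd-switch θ S) (cov v))
                          (λ cov v → transfer sssd-unswitch (cov v))
    where
    transfer : ∀ {S′ S″ : SignedDigraph n} {v} → (∀ {x} → SSSD S′ x v p → SSSD S″ x v p) →
               (Σ (Fin n) λ x → (x ∈ X) × SSSD S′ x v p) → Σ (Fin n) λ x → (x ∈ X) × SSSD S″ x v p
    transfer f (x , x∈X , pair) = x , x∈X , f pair

*-≡-*+⇒ : ∀ k {x y z} .{{_ : NonZero k}} → x * k ≡ y * k + z → ∃ λ d → x ≡ y + d × d * k ≡ z
*-≡-*+⇒ k {x} {y} {z} xk≡yk+z = x ∸ y , sym (m+[n∸m]≡n y≤x) , +-cancelˡ-≡ (y * k) _ _ (begin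
    y * k + (x ∸ y) * k  ≡⟨ *-distribʳ-+ k y (x ∸ y) ⟨
    (y + (x ∸ y)) * k    ≡⟨ cong (_* k) (m+[n∸m]≡n y≤x) ⟩
    x * k                ≡⟨ xk≡yk+z ⟩
    y * k + z            ∎)
  where
  open ≡-Reasoning
  y≤x : y ≤ x
  y≤x = *-cancelʳ-≤ y x k (subst (y * k ≤_) (sym xk≡yk+z) (m≤m+n (y * k) z))

consecutive-combination : ∀ k {α₁ s₁ α₂ s₂} →
  α₁ * suc (suc k) + s₁ * suc k ≡ α₂ * suc (suc k) + s₂ * suc k → α₁ < α₂ →
  ∃ λ t → α₂ ≡ α₁ + suc t * suc k × s₁ ≡ s₂ + suc t * suc (suc k)
consecutive-combination k {α₁} {s₁} {α₂} {s₂} eq α₁<α₂ with o , refl ← m≤n⇒∃[o]m+o≡n α₁<α₂ =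
  balance (+-cancelˡ-≡ (α₁ * suc (suc k)) _ _ (trans eq (regroup α₁ o s₂ k)))
  where
  regroup : ∀ α o s k → suc (α + o) * suc (suc k) + s * suc k
                      ≡ α * suc (suc k) + (s * suc k + suc o * suc (suc k))
  regroup = solve-∀
  balance : ∀ {s₁} → s₁ * suc k ≡ s₂ * suc k + suc o * suc (suc k) →
            ∃ λ t → suc α₁ + o ≡ α₁ + suc t * suc k × s₁ ≡ s₂ + suc t * suc (suc k)
  balance {s₁} sK with e , refl , eK ← *-≡-*+⇒ (suc k) {s₁} {s₂} sK
              with *-≡-*+⇒ (suc k) {e} {suc o} (trans eK (trans (*-suc (suc o) (suc k)) (+-comm (suc o) _)))
  ... | suc t , refl , gK =
    t , trans (sym (+-suc α₁ o)) (cong (α₁ +_) (sym gK)) ,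
    cong (s₂ +_) (trans (cong (_+ suc t) (sym gK)) (trans (+-comm _ (suc t)) (sym (*-suc (suc t) (suc k)))))

quotient-≤ : ∀ k {A y α M} → A * k + y ≡ α + M * k → y < k → M ≤ A × y ≤ α
quotient-≤ k {A} {y} {α} {M} eq y<k = M≤A , remainder≤ M≤A eq
  where
  M≤A : M ≤ A
  M≤A = ≮⇒≥ λ A<M → <⇒≱ (begin-strict
    A * k + y  <⟨ +-monoʳ-< (A * k) y<k ⟩
    A * k + k  ≡⟨ +-comm (A * k) k ⟩
    suc A * k  ≤⟨ *-monoˡ-≤ k A<M ⟩
    M * k      ≤⟨ m≤n+m (M * k) α ⟩
    α + M * k  ∎) (≤-reflexive (sym eq))
    where open ≤-Reasoning
  regroup : ∀ M D k y → D * k + y + M * k ≡ (M + D) * k + y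
  regroup = solve-∀
  remainder≤ : ∀ {A} → M ≤ A → A * k + y ≡ α + M * k → y ≤ α
  remainder≤ M≤A′ eq′ with D , refl ← m≤n⇒∃[o]m+o≡n M≤A′ =
    subst (y ≤_) (+-cancelʳ-≡ (M * k) _ _ (trans (regroup M D k y) eq′)) (m≤n+m y (D * k))

-- The digraph D₂ of order m + 2

-- Vertex i : Fin N stands for the paper's vertex i + 1, so A, B and C are the arcs K → 0,
-- m → 0 and K → 1.
module OnD₂ (m : ℕ) where

  N K : ℕ
  N = suc (suc m)
  K = suc m

  -- Opaque, so that unification never unfolds _mod_ on open terms.
  opaque
    vertex : ℕ → Fin N
    vertex i = i mod N

    toℕ-vertex : ∀ {i} → i < N → toℕ (vertex i) ≡ i
    toℕ-vertex {i} i<N = trans (toℕ-fromℕ< (m%n<n i N)) (m<n⇒m%n≡m i<N)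

    vertex-+* : ∀ i j → vertex (i + j * N) ≡ vertex i
    vertex-+* i j = toℕ-injective (trans (toℕ-fromℕ< (m%n<n (i + j * N) N))
                                 (trans ([m+kn]%n≡m%n i j N) (sym (toℕ-fromℕ< (m%n<n i N)))))

  vertex-toℕ : ∀ u → vertex (toℕ u) ≡ u
  vertex-toℕ u = toℕ-injective (toℕ-vertex (toℕ<n u))

  D₂-forward : ∀ {i} → i < K → D₂ N (vertex i) (vertex (suc i))
  D₂-forward {i} i<K =
    inj₁ (cong suc (trans (toℕ-vertex (s≤s i<K)) (cong suc (sym (toℕ-vertex (m≤n⇒m≤1+n i<K))))))

  D₂-A : D₂ N (vertex K) (vertex 0)
  D₂-A = inj₂ (inj₁ (cong suc (toℕ-vertex ≤-refl) , cong suc (toℕ-vertex (s≤s z≤n))))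

  D₂-B : D₂ N (vertex m) (vertex 0)
  D₂-B = inj₂ (inj₂ (inj₁ (cong suc (toℕ-vertex (n≤1+n _)) , cong suc (toℕ-vertex (s≤s z≤n)))))

  D₂-C : D₂ N (vertex K) (vertex 1)
  D₂-C = inj₂ (inj₂ (inj₂ (cong suc (toℕ-vertex ≤-refl) , cong suc (toℕ-vertex (s≤s (s≤s z≤n))))))

  toℕ≤K : (u : Fin N) → toℕ u ≤ K
  toℕ≤K u = s≤s⁻¹ (toℕ<n u)

  -- d is the residue of x - v modulo N.
  data Offset (x v d : ℕ) : Set where
    same : x ≡ v + d → Offset x v d
    wrap : x + N ≡ v + d → Offset x v d

  offset : ∀ {x v} → x ≤ K → v ≤ K → Σ ℕ λ d → d ≤ K × Offset x v d
  offset {x} {v} x≤K v≤K with v ≤? x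
  ... | yes v≤x with d , refl ← m≤n⇒∃[o]m+o≡n v≤x = d , ≤-trans (m≤n+m d v) x≤K , same refl
  ... | no v≰x with d , v+d≡x+N ← m≤n⇒∃[o]m+o≡n (≤-trans v≤K (≤-trans (n≤1+n K) (m≤n+m N x))) =
    d , +-cancelˡ-≤ v d K (begin
      v + d      ≡⟨ v+d≡x+N ⟩
      x + N      ≡⟨ +-suc x K ⟩
      suc x + K  ≤⟨ +-monoˡ-≤ K (≰⇒> v≰x) ⟩
      v + K      ∎) ,
    wrap (sym v+d≡x+N)
    where open ≤-Reasoning

  wrap⇒≤m : ∀ {x v d} → x + N ≡ v + d → v ≤ K → d ≤ K → x ≤ m
  wrap⇒≤m {x} {v} {d} x+N v≤K d≤K = s≤s⁻¹ (+-cancelʳ-≤ K (suc x) K (begin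
    suc x + K  ≡⟨ +-suc x K ⟨
    x + N      ≡⟨ x+N ⟩
    v + d      ≤⟨ +-mono-≤ v≤K d≤K ⟩
    K + K      ∎))
    where open ≤-Reasoning

  same-length : ∀ {x v d p e} → x ≡ v + d → p + d ≡ e → p + x ≡ v + e
  same-length {x} {v} {d} {p} refl p+d =
    trans (+-comm p (v + d)) (trans (+-assoc v d p) (cong (v +_) (trans (+-comm d p) p+d)))

  wrap-length : ∀ {x v d p e} → x + N ≡ v + d → p + d ≡ e + N → p + x ≡ v + e
  wrap-length {x} {v} {d} {p} {e} x+N p+d = +-cancelʳ-≡ N _ _ (begin
    p + x + N    ≡⟨ +-assoc p x N ⟩
    p + (x + N)  ≡⟨ cong (p +_) x+N ⟩
    p + (v + d)  ≡⟨ same-length {v + d} {v} {d} {p} {e + N} refl p+d ⟩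
    v + (e + N)  ≡⟨ +-assoc v e N ⟨
    v + e + N    ∎)
    where open ≡-Reasoning

  Excluded : ℕ → ℕ → ℕ → Set
  Excluded c k d = Σ ℕ λ j → Σ ℕ λ t → t < k × d + j * N ≡ c + t

  vertex-≡ : ∀ (u : Fin N) i {y} → toℕ u + i * N ≡ y → u ≡ vertex y
  vertex-≡ u i refl = trans (sym (vertex-toℕ u)) (sym (vertex-+* (toℕ u) i))

  +-assoc-cong : ∀ v {c t d e} → d + e ≡ c + t → v + d + e ≡ v + c + t
  +-assoc-cong v {c} {t} {d} {e} eq = trans (+-assoc v d e) (trans (cong (v +_) eq) (sym (+-assoc v c t)))

  not-excluded : ∀ {xf vf : Fin N} {c k d} → Offset (toℕ xf) (toℕ vf) d →
                 (∀ t → t < k → xf ≢ vertex (toℕ vf + c + t)) → ¬ Excluded c k d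
  not-excluded {xf} {vf} (same x≡v+d) avoids (j , t , t<k , d+jN) =
    avoids t t<k (vertex-≡ xf j (trans (cong (_+ j * N) x≡v+d) (+-assoc-cong (toℕ vf) d+jN)))
  not-excluded {xf} {vf} (wrap x+N≡v+d) avoids (j , t , t<k , d+jN) =
    avoids t t<k (vertex-≡ xf (suc j) (trans (sym (+-assoc (toℕ xf) N (j * N)))
                                      (trans (cong (_+ j * N) x+N≡v+d) (+-assoc-cong (toℕ vf) d+jN))))

  within-or-excluded : ∀ {K₀ k d} → K₀ + k ≡ K → d ≤ K → d ≤ K₀ ⊎ Excluded (suc K₀) k d
  within-or-excluded {K₀} {k} {d} K₀+k d≤K with d ≤? K₀
  ... | yes d≤K₀ = inj₁ d≤K₀
  ... | no d≰K₀ with t , refl ← m≤n⇒∃[o]m+o≡n (≰⇒> d≰K₀) =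
    inj₂ (0 , t , +-cancelˡ-< K₀ t k (subst (suc K₀ + t ≤_) (sym K₀+k) d≤K) , +-identityʳ _)

  data Swappable (K₀ d : ℕ) : Set where
    short : ∀ B → K₀ ≡ suc (suc d) + B → Swappable K₀ d
    at-m  : d ≡ m → Swappable K₀ d
    at-K  : ∀ K₁ → d ≡ K → K₀ ≡ suc K₁ → Swappable K₀ d

  swappable-or-excluded : ∀ {K₀ k d} → K₀ + k ≡ K → d ≤ K → Swappable K₀ d ⊎ Excluded (K₀ + K) k d
  swappable-or-excluded {K₀} {k} {d} K₀+k d≤K with suc (suc d) ≤? K₀
  ... | yes 2+d≤K₀ with B , refl ← m≤n⇒∃[o]m+o≡n 2+d≤K₀ = inj₁ (short B refl)
  ... | no 2+d≰K₀ with d ≟ m | d ≟ K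
  ...   | yes refl | _ = inj₁ (at-m refl)
  ...   | no _ | yes refl with K₀
  ...     | suc K₁ = inj₁ (at-K K₁ refl refl)
  ...     | zero = inj₂ (0 , 0 , subst (0 <_) (sym K₀+k) (s≤s z≤n) , refl)
  swappable-or-excluded {K₀} {k} {d} K₀+k d≤K | no 2+d≰K₀ | no d≢m | no d≢K
    with t , K₀+t ← m≤n⇒∃[o]m+o≡n (s≤s⁻¹ (≰⇒> 2+d≰K₀)) =
    inj₂ (1 , t , +-cancelˡ-< K₀ t k t<k , d+N)
    where
    d<m : d < m
    d<m = ≤∧≢⇒< (s≤s⁻¹ (≤∧≢⇒< d≤K d≢K)) d≢m
    t<k : K₀ + t < K₀ + k
    t<k = subst₂ _<_ (sym K₀+t) (sym K₀+k) (s≤s d<m)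
    d+N : d + 1 * N ≡ K₀ + K + t
    d+N = begin
      d + 1 * N      ≡⟨ cong (d +_) (+-identityʳ N) ⟩
      d + N          ≡⟨ +-suc d K ⟩
      suc d + K      ≡⟨ cong (_+ K) K₀+t ⟨
      K₀ + t + K     ≡⟨ +-assoc K₀ t K ⟩
      K₀ + (t + K)   ≡⟨ cong (K₀ +_) (+-comm t K) ⟩
      K₀ + (K + t)   ≡⟨ +-assoc K₀ K t ⟨
      K₀ + K + t     ∎
      where open ≡-Reasoning

  quotient-bound-suc : ∀ {R A y α s} → R + A * K + suc y ≡ suc R + (α * N + (N + s) * K) → y < K → N + y ≤ A
  quotient-bound-suc {R} {A} {y} {α} {s} eq y<K = N+y≤A (quotient-≤ K eq′ y<K)
    where
    N+y≤A : α + N + s ≤ A × y ≤ α → N + y ≤ A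
    N+y≤A (M≤A , y≤α) = begin
      N + y      ≤⟨ +-monoʳ-≤ N y≤α ⟩
      N + α      ≡⟨ +-comm N α ⟩
      α + N      ≤⟨ m≤m+n (α + N) s ⟩
      α + N + s  ≤⟨ M≤A ⟩
      A          ∎
      where open ≤-Reasoning
    regroupˡ : ∀ R A y m → R + A * suc m + suc y ≡ suc R + (A * suc m + y)
    regroupˡ = solve-∀
    regroupʳ : ∀ R α s m → suc R + (α * suc (suc m) + (suc (suc m) + s) * suc m)
                          ≡ suc R + (α + (α + suc (suc m) + s) * suc m)
    regroupʳ = solve-∀
    eq′ : A * K + y ≡ α + (α + N + s) * K
    eq′ = +-cancelˡ-≡ (suc R) _ _ (trans (sym (regroupˡ R A y m)) (trans eq (regroupʳ R α s m)))

  quotient-bound-zero : ∀ {R A α s} → R + A * K + 0 ≡ suc R + (α * N + (N + s) * K) → N + K ≤ A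
  quotient-bound-zero {R} {zero} eq =
    contradiction (trans (sym (trans (+-identityʳ _) (+-identityʳ R))) eq) (m≢1+m+n R)
  quotient-bound-zero {R} {suc A} {α} {s} eq =
    subst (_≤ suc A) (sym (+-suc N m)) (s≤s (quotient-bound-suc {R} {A} {m} {α} {s} eq′ ≤-refl))
    where
    regroup : ∀ R A m → R + suc A * suc m + 0 ≡ R + A * suc m + suc m
    regroup = solve-∀
    eq′ : R + A * K + suc m ≡ suc R + (α * N + (N + s) * K)
    eq′ = trans (sym (regroup R A m)) eq

  run : ℕ → ℕ → List (Fin N)
  run c zero = []
  run c (suc L) = vertex c ∷ run (suc c) L

  tabulate≡run : ∀ {L} c (g : Fin L → Fin N) → (∀ j → g j ≡ vertex (c + toℕ j)) → tabulate g ≡ run c L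
  tabulate≡run {zero} c g g≡ = refl
  tabulate≡run {suc L} c g g≡ =
    cong₂ _∷_ (trans (g≡ Fin.zero) (cong vertex (+-identityʳ c)))
              (tabulate≡run (suc c) (g ∘ Fin.suc) λ j → trans (g≡ (Fin.suc j)) (cong vertex (+-suc c (toℕ j))))

  allFin≡run : allFin N ≡ run 0 N
  allFin≡run = tabulate≡run 0 id λ j → sym (vertex-toℕ j)

  run-snoc : ∀ c L → run c (suc L) ≡ run c L ++ vertex (c + L) ∷ []
  run-snoc c zero = cong (λ i → vertex i ∷ []) (sym (+-identityʳ c))
  run-snoc c (suc L) =
    cong (vertex c ∷_) (trans (run-snoc (suc c) L) (cong (λ i → run (suc c) L ++ vertex i ∷ []) (sym (+-suc c L))))

  All-run : ∀ {P : Fin N → Set} c L → (∀ j → j < L → P (vertex (c + j))) → All P (run c L)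
  All-run c zero _ = []
  All-run {P} c (suc L) P-run =
    subst P (cong vertex (+-identityʳ c)) (P-run 0 (s≤s z≤n)) ∷
    All-run (suc c) L λ j j<L → subst P (cong vertex (+-suc c j)) (P-run (suc j) (s≤s j<L))

  C₁≡run : C₁ N ≡ run 0 K
  C₁≡run = begin
    filter P? (allFin N)                             ≡⟨ cong (filter P?) (trans allFin≡run (run-snoc 0 K)) ⟩
    filter P? (run 0 K ++ vertex K ∷ [])             ≡⟨ filter-++ P? (run 0 K) _ ⟩
    filter P? (run 0 K) ++ filter P? (vertex K ∷ []) ≡⟨ cong₂ _++_ (filter-all P? (All-run 0 K kept))
                                                                   (filter-reject P? rejected) ⟩
    run 0 K ++ []                                    ≡⟨ ++-identityʳ _ ⟩
    run 0 K                                          ∎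
    where
    open ≡-Reasoning
    P? = λ (v : Fin N) → suc (toℕ v) ≤? N ∸ 1
    kept : ∀ j → j < K → suc (toℕ (vertex j)) ≤ K
    kept j j<K = subst (λ i → suc i ≤ K) (sym (toℕ-vertex (m≤n⇒m≤1+n j<K))) j<K
    rejected : ¬ suc (toℕ (vertex K)) ≤ K
    rejected K<K = 1+n≰n (subst (λ i → suc i ≤ K) (toℕ-vertex ≤-refl) K<K)

  C₂≡run : C₂ N ≡ run 1 K
  C₂≡run = begin
    filter P? (allFin N)           ≡⟨ cong (filter P?) allFin≡run ⟩
    filter P? (vertex 0 ∷ run 1 K) ≡⟨ filter-reject P? rejected ⟩
    filter P? (run 1 K)            ≡⟨ filter-all P? (All-run 1 K kept) ⟩
    run 1 K                        ∎
    where
    open ≡-Reasoning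
    P? = λ (v : Fin N) → 2 ≤? suc (toℕ v)
    kept : ∀ j → j < K → 2 ≤ suc (toℕ (vertex (1 + j)))
    kept j j<K = subst (λ i → 2 ≤ suc i) (sym (toℕ-vertex (s≤s j<K))) (s≤s (s≤s z≤n))
    rejected : ¬ 2 ≤ suc (toℕ (vertex 0))
    rejected 2≤1 = 1+n≰n (subst (λ i → 2 ≤ suc i) (toℕ-vertex (s≤s z≤n)) 2≤1)

  module Positive (T : SignedDigraph N) (T-arcs : SameDigraph (Underlying T) (D₂ N))
                  (forward-pos : ∀ i → i < K → T (vertex i) (vertex (suc i)) ≡ just pos) where

    arc : ∀ {u w} → D₂ N u w → ∃ λ s → T u w ≡ just s
    arc d = Is-just⇒≡just (Equivalence.from (T-arcs _ _) d)

    a b c : Sign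
    a = proj₁ (arc D₂-A)
    b = proj₁ (arc D₂-B)
    c = proj₁ (arc D₂-C)

    -- Forward arcs cost no excess; the arcs A, B and C cost N, K and K.
    record Reach (i j e : ℕ) (s : Sign) : Set where
      constructor reach
      field
        length : ℕ
        excess : length + i ≡ j + e
        walk   : SignedWalk T (vertex i) (vertex j) length s

    infixr 5 _⨾_

    _⨾_ : ∀ {i j k e e′ s t} → Reach i j e s → Reach j k e′ t → Reach i k (e + e′) (s · t)
    _⨾_ {i} {j} {k} {e} {e′} (reach l l+i (p , p-sign)) (reach l′ l′+j (q , q-sign)) =
      reach (l + l′) l+l′+i (p ++ʷ q , trans (walkSign-++ʷ p q) (cong₂ _·_ p-sign q-sign))
      where
      open ≡-Reasoning
      l+l′+i : l + l′ + i ≡ k + (e + e′)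
      l+l′+i = begin
        l + l′ + i    ≡⟨ cong (_+ i) (+-comm l l′) ⟩
        l′ + l + i    ≡⟨ +-assoc l′ l i ⟩
        l′ + (l + i)  ≡⟨ cong (l′ +_) l+i ⟩
        l′ + (j + e)  ≡⟨ +-assoc l′ j e ⟨
        l′ + j + e    ≡⟨ cong (_+ e) l′+j ⟩
        k + e′ + e    ≡⟨ +-assoc k e′ e ⟩
        k + (e′ + e)  ≡⟨ cong (k +_) (+-comm e′ e) ⟩
        k + (e + e′)  ∎

    -- Opaque, so that Agda never normalises the ring-solver proofs handed to it.
    opaque
      reach-cast : ∀ {i j e e′ s s′} → e ≡ e′ → s ≡ s′ → Reach i j e s → Reach i j e′ s′
      reach-cast refl refl r = r

    stay : ∀ {i} → Reach i i 0 pos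
    stay {i} = reach 0 (+-comm 0 i) ([] , refl)

    forward : ∀ {i j} → i ≤ j → j ≤ K → Reach i j 0 pos
    forward {j = zero} z≤n _ = stay
    forward {i} {suc j} i≤1+j 1+j≤K with m≤n⇒m<n∨m≡n i≤1+j
    ... | inj₂ refl = stay
    ... | inj₁ i<1+j =
      forward (s≤s⁻¹ i<1+j) (<⇒≤ 1+j≤K) ⨾ reach 1 (sym (+-identityʳ _)) (forward-pos j 1+j≤K ∷ [] , refl)

    arcA : Reach K 0 N a
    arcA = reach 1 refl (proj₂ (arc D₂-A) ∷ [] , ·-identityʳ a)

    arcB : Reach m 0 K b
    arcB = reach 1 refl (proj₂ (arc D₂-B) ∷ [] , ·-identityʳ b)

    arcC : Reach K 1 K c
    arcC = reach 1 refl (proj₂ (arc D₂-C) ∷ [] , ·-identityʳ c)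

    cycleA : Reach 0 0 N a
    cycleA = forward z≤n ≤-refl ⨾ arcA

    cycleB : Reach 0 0 K b
    cycleB = forward z≤n (n≤1+n m) ⨾ arcB

    cycleC : Reach 1 1 K c
    cycleC = forward (s≤s z≤n) ≤-refl ⨾ arcC

    repeat : ∀ {i e s} → Reach i i e s → ∀ r → Reach i i (r * e) (s ^ r)
    repeat cyc zero = stay
    repeat cyc (suc r) = cyc ⨾ repeat cyc r

    cyclesLength : ℕ → ℕ → ℕ → ℕ
    cyclesLength α β γ = α * N + (β + γ) * K

    cyclesSign : ℕ → ℕ → ℕ → Sign
    cyclesSign α β γ = a ^ α · (b ^ β · c ^ γ)

    ReachBy : ℕ → ℕ → ℕ → ℕ → ℕ → Set
    ReachBy x v α β γ = Reach x v (cyclesLength α β γ) (cyclesSign α β γ)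

    reach-A : ∀ {x v} → x ≤ K → v ≤ K → ∀ α β → ReachBy x v (suc α) β 0
    reach-A x≤K v≤K α β =
      reach-cast (excess α β m) (sym (·-assoc a _ _))
        (forward x≤K ≤-refl ⨾ arcA ⨾ repeat cycleA α ⨾ repeat cycleB β ⨾ forward z≤n v≤K)
      where
      excess : ∀ α β m → 0 + (suc (suc m) + (α * suc (suc m) + (β * suc m + 0)))
                       ≡ suc α * suc (suc m) + (β + 0) * suc m
      excess = solve-∀

    reach-low : ∀ {x v} → x ≤ m → v ≤ K → ∀ α β → ReachBy x v α (suc β) 0
    reach-low x≤m v≤K (suc α) β = reach-A (m≤n⇒m≤1+n x≤m) v≤K α (suc β)
    reach-low x≤m v≤K zero β =
      reach-cast (excess β m) (sym (·-assoc b _ _))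
        (forward x≤m (n≤1+n m) ⨾ arcB ⨾ repeat cycleB β ⨾ forward z≤n v≤K)
      where
      excess : ∀ β m → 0 + (suc m + (β * suc m + 0)) ≡ 0 * suc (suc m) + (suc β + 0) * suc m
      excess = solve-∀

    reach-AC : ∀ {x v} → x ≤ K → v ≤ K → ∀ α β → ReachBy x v (suc α) β 1
    reach-AC {v = suc _} x≤K v≤K α β =
      reach-cast (excess α β m) (sym (·-assoc a _ _))
        (forward x≤K ≤-refl ⨾ arcA ⨾ repeat cycleA α ⨾ repeat cycleB β ⨾
         forward z≤n ≤-refl ⨾ arcC ⨾ forward (s≤s z≤n) v≤K)
      where
      excess : ∀ α β m → 0 + (suc (suc m) + (α * suc (suc m) + (β * suc m + (0 + (suc m + 0)))))
                       ≡ suc α * suc (suc m) + (β + 1) * suc m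
      excess = solve-∀
    reach-AC {v = zero} x≤K v≤K α β =
      reach-cast (excess α β m) (C-last (a ^ α) (b ^ β))
        (forward x≤K ≤-refl ⨾ arcC ⨾ forward (s≤s z≤n) ≤-refl ⨾ arcA ⨾
         repeat cycleA α ⨾ repeat cycleB β ⨾ forward z≤n z≤n)
      where
      excess : ∀ α β m → 0 + (suc m + (0 + (suc (suc m) + (α * suc (suc m) + (β * suc m + 0)))))
                       ≡ suc α * suc (suc m) + (β + 1) * suc m
      excess = solve-∀
      C-last : ∀ r s → c · (a · (r · (s · pos))) ≡ (a · r) · (s · (c · pos))
      C-last r s = begin
        c · (a · (r · (s · pos)))  ≡⟨ ·-exchange c a _ ⟩
        a · (c · (r · (s · pos)))  ≡⟨ cong (a ·_) (·-exchange c r _) ⟩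
        a · (r · (c · (s · pos)))  ≡⟨ cong (λ t → a · (r · t)) (·-exchange c s pos) ⟩
        a · (r · (s · (c · pos)))  ≡⟨ ·-assoc a r _ ⟨
        (a · r) · (s · (c · pos))  ∎
        where open ≡-Reasoning

    reach-BC : ∀ {x v} → x ≤ m → 1 ≤ v → v ≤ K → ∀ β → ReachBy x v 0 β 1
    reach-BC x≤m 1≤v v≤K zero =
      reach-cast (excess m) refl (forward (m≤n⇒m≤1+n x≤m) ≤-refl ⨾ arcC ⨾ forward 1≤v v≤K)
      where
      excess : ∀ m → 0 + (suc m + 0) ≡ 0 * suc (suc m) + (0 + 1) * suc m
      excess = solve-∀
    reach-BC x≤m 1≤v v≤K (suc β) =
      reach-cast (excess β m) (cong (pos ·_) (sym (·-assoc b _ _)))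
        (forward x≤m (n≤1+n m) ⨾ arcB ⨾ repeat cycleB β ⨾ forward z≤n ≤-refl ⨾ arcC ⨾ forward 1≤v v≤K)
      where
      excess : ∀ β m → 0 + (suc m + (β * suc m + (0 + (suc m + 0))))
                     ≡ 0 * suc (suc m) + (suc β + 1) * suc m
      excess = solve-∀

    reach-C : ∀ γ → ReachBy K K 0 0 (suc γ)
    reach-C γ =
      reach-cast (excess γ m) (cong (c ·_) (·-identityʳ _))
        (arcC ⨾ repeat cycleC γ ⨾ forward (s≤s z≤n) ≤-refl)
      where
      excess : ∀ γ m → suc m + (γ * suc m + 0) ≡ 0 * suc (suc m) + (0 + suc γ) * suc m
      excess = solve-∀

    record CycleCount (u v l : ℕ) (s : Sign) : Set where
      field
        α β γ   : ℕ
        length≡ : l + u ≡ v + cyclesLength α β γ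
        sign≡   : s ≡ cyclesSign α β γ

    sign-at : ∀ {u w i j s t} → toℕ u ≡ i → toℕ w ≡ j →
              T (vertex i) (vertex j) ≡ just s → T u w ≡ just t → t ≡ s
    sign-at {u} {w} refl refl e e′ =
      just-injective (trans (sym e′) (subst₂ (λ u′ w′ → T u′ w′ ≡ _) (vertex-toℕ u) (vertex-toℕ w) e))

    step-length : ∀ {l u w v δ E} → suc u ≡ w + δ → l + w ≡ v + E → suc l + u ≡ v + (δ + E)
    step-length {l} {u} {w} {v} {δ} {E} u+1 l+w = begin
      suc l + u     ≡⟨ +-suc l u ⟨
      l + suc u     ≡⟨ cong (l +_) u+1 ⟩
      l + (w + δ)   ≡⟨ +-assoc l w δ ⟨
      l + w + δ     ≡⟨ cong (_+ δ) l+w ⟩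
      v + E + δ     ≡⟨ +-assoc v E δ ⟩
      v + (E + δ)   ≡⟨ cong (v +_) (+-comm E δ) ⟩
      v + (δ + E)   ∎
      where open ≡-Reasoning

    cyclesLength-sucα : ∀ α β γ → N + cyclesLength α β γ ≡ cyclesLength (suc α) β γ
    cyclesLength-sucα α β γ = sym (+-assoc N (α * N) _)

    cyclesLength-sucβ : ∀ α β γ → K + cyclesLength α β γ ≡ cyclesLength α (suc β) γ
    cyclesLength-sucβ α β γ = lemma α β γ m
      where
      lemma : ∀ α β γ m → suc m + (α * suc (suc m) + (β + γ) * suc m)
                        ≡ α * suc (suc m) + (suc β + γ) * suc m
      lemma = solve-∀

    cyclesLength-sucγ : ∀ α β γ → K + cyclesLength α β γ ≡ cyclesLength α β (suc γ)
    cyclesLength-sucγ α β γ = lemma α β γ m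
      where
      lemma : ∀ α β γ m → suc m + (α * suc (suc m) + (β + γ) * suc m)
                        ≡ α * suc (suc m) + (β + suc γ) * suc m
      lemma = solve-∀

    cyclesSign-sucα : ∀ α β γ → a · cyclesSign α β γ ≡ cyclesSign (suc α) β γ
    cyclesSign-sucα α β γ = sym (·-assoc a (a ^ α) _)

    cyclesSign-sucβ : ∀ α β γ → b · cyclesSign α β γ ≡ cyclesSign α (suc β) γ
    cyclesSign-sucβ α β γ = trans (·-exchange b (a ^ α) _) (cong (a ^ α ·_) (sym (·-assoc b (b ^ β) _)))

    cyclesSign-sucγ : ∀ α β γ → c · cyclesSign α β γ ≡ cyclesSign α β (suc γ)
    cyclesSign-sucγ α β γ = trans (·-exchange c (a ^ α) _) (cong (a ^ α ·_) (·-exchange c (b ^ β) _))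

    data ArcKind (u w : ℕ) : Sign → Set where
      forward-arc : w ≡ suc u → ArcKind u w pos
      A-arc       : u ≡ K → w ≡ 0 → ArcKind u w a
      B-arc       : u ≡ m → w ≡ 0 → ArcKind u w b
      C-arc       : u ≡ K → w ≡ 1 → ArcKind u w c

    arc-kind : ∀ {u w t} → T u w ≡ just t → ArcKind (toℕ u) (toℕ w) t
    arc-kind {u} {w} e with Equivalence.to (T-arcs u w) (subst Is-just (sym e) (just tt))
    ... | inj₁ w≡u+1 = subst (ArcKind _ _) (sym (sign-at refl w≡ (forward-pos (toℕ u) u<K) e)) (forward-arc w≡)
      where
      w≡ = suc-injective w≡u+1
      u<K = s≤s⁻¹ (subst (_< N) w≡ (toℕ<n w))
    ... | inj₂ (inj₁ (u≡K , w≡0)) =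
      subst (ArcKind _ _) (sym (sign-at u≡ w≡ (proj₂ (arc D₂-A)) e)) (A-arc u≡ w≡)
      where u≡ = suc-injective u≡K; w≡ = suc-injective w≡0
    ... | inj₂ (inj₂ (inj₁ (u≡m , w≡0))) =
      subst (ArcKind _ _) (sym (sign-at u≡ w≡ (proj₂ (arc D₂-B)) e)) (B-arc u≡ w≡)
      where u≡ = suc-injective u≡m; w≡ = suc-injective w≡0
    ... | inj₂ (inj₂ (inj₂ (u≡K , w≡1))) =
      subst (ArcKind _ _) (sym (sign-at u≡ w≡ (proj₂ (arc D₂-C)) e)) (C-arc u≡ w≡)
      where u≡ = suc-injective u≡K; w≡ = suc-injective w≡1

    count-step : ∀ {u w v l s t} → ArcKind u w t → CycleCount w v l s → CycleCount u v (suc l) (t · s)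
    count-step {v = v} (forward-arc w≡u+1) record { α = α ; β = β ; γ = γ ; length≡ = l+w ; sign≡ = s≡ } =
      record { α = α ; β = β ; γ = γ
             ; length≡ = step-length {v = v} {E = cyclesLength α β γ}
                           (trans (sym w≡u+1) (sym (+-identityʳ _))) l+w
             ; sign≡ = s≡ }
    count-step {v = v} (A-arc u≡K w≡0) record { α = α ; β = β ; γ = γ ; length≡ = l+w ; sign≡ = s≡ } =
      record { α = suc α ; β = β ; γ = γ
             ; length≡ = trans (step-length (trans (cong suc u≡K) (cong (_+ N) (sym w≡0))) l+w)
                               (cong (v +_) (cyclesLength-sucα α β γ))
             ; sign≡ = trans (cong (a ·_) s≡) (cyclesSign-sucα α β γ) }
    count-step {v = v} (B-arc u≡m w≡0) record { α = α ; β = β ; γ = γ ; length≡ = l+w ; sign≡ = s≡ } =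
      record { α = α ; β = suc β ; γ = γ
             ; length≡ = trans (step-length (trans (cong suc u≡m) (cong (_+ K) (sym w≡0))) l+w)
                               (cong (v +_) (cyclesLength-sucβ α β γ))
             ; sign≡ = trans (cong (b ·_) s≡) (cyclesSign-sucβ α β γ) }
    count-step {v = v} (C-arc u≡K w≡1) record { α = α ; β = β ; γ = γ ; length≡ = l+w ; sign≡ = s≡ } =
      record { α = α ; β = β ; γ = suc γ
             ; length≡ = trans (step-length (trans (cong suc u≡K) (cong (_+ K) (sym w≡1))) l+w)
                               (cong (v +_) (cyclesLength-sucγ α β γ))
             ; sign≡ = trans (cong (c ·_) s≡) (cyclesSign-sucγ α β γ) }

    count-cycles : ∀ {u v l} (p : Walk T u v l) → CycleCount (toℕ u) (toℕ v) l (walkSign p)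
    count-cycles [] = record { α = 0 ; β = 0 ; γ = 0 ; length≡ = sym (+-identityʳ _) ; sign≡ = refl }
    count-cycles (e ∷ p) = count-step (arc-kind e) (count-cycles p)

    sssd-from : ∀ {x v e s s′} p → p + x ≡ v + e → Reach x v e s → Reach x v e s′ → s ≢ s′ →
                SSSD T (vertex x) (vertex v) p
    sssd-from {x} p p+x (reach l l+x (w , w-sign)) (reach l′ l′+x (w′ , w′-sign)) s≢s′
      with +-cancelʳ-≡ x l p (trans l+x (sym p+x)) | +-cancelʳ-≡ x l′ p (trans l′+x (sym p+x))
    ... | refl | refl = w , w′ , λ e → s≢s′ (trans (sym w-sign) (trans e w′-sign))

    swap-B-C : b ≢ c → ∀ α β → cyclesSign α (suc β) 0 ≢ cyclesSign α β 1
    swap-B-C b≢c α β eq = b≢c (·-cancelʳ (b ^ β) (begin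
      b · b ^ β          ≡⟨ ·-identityʳ _ ⟨
      (b · b ^ β) · pos  ≡⟨ ·-cancelˡ (a ^ α) eq ⟩
      b ^ β · (c · pos)  ≡⟨ cong (b ^ β ·_) (·-identityʳ c) ⟩
      b ^ β · c          ≡⟨ ·-comm (b ^ β) c ⟩
      c · b ^ β          ∎))
      where open ≡-Reasoning

    swap-B-C-length : ∀ α β → cyclesLength α (suc β) 0 ≡ cyclesLength α β 1
    swap-B-C-length α β = cong (λ s → α * N + s * K) (trans (+-identityʳ (suc β)) (+-comm 1 β))

    trade-A-B : a ^ K ≢ b ^ N → ∀ α β → cyclesSign (K + α) β 0 ≢ cyclesSign α (N + β) 0
    trade-A-B aᴷ≢bᴺ α β eq = aᴷ≢bᴺ (·-cancelʳ (a ^ α · (b ^ β · pos)) (begin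
      a ^ K · (a ^ α · (b ^ β · pos))    ≡⟨ ·-assoc (a ^ K) _ _ ⟨
      (a ^ K · a ^ α) · (b ^ β · pos)    ≡⟨ cong (_· (b ^ β · pos)) (^-+ a K α) ⟨
      a ^ (K + α) · (b ^ β · pos)        ≡⟨ eq ⟩
      a ^ α · (b ^ (N + β) · pos)        ≡⟨ cong (λ s → a ^ α · (s · pos)) (^-+ b N β) ⟩
      a ^ α · ((b ^ N · b ^ β) · pos)    ≡⟨ cong (a ^ α ·_) (·-assoc (b ^ N) _ _) ⟩
      a ^ α · (b ^ N · (b ^ β · pos))    ≡⟨ ·-exchange (a ^ α) (b ^ N) _ ⟩
      b ^ N · (a ^ α · (b ^ β · pos))    ∎))
      where open ≡-Reasoning

    trade-A-B-length : ∀ α β → cyclesLength (K + α) β 0 ≡ cyclesLength α (N + β) 0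
    trade-A-B-length α β = lemma α β m
      where
      lemma : ∀ α β m → (suc m + α) * suc (suc m) + (β + 0) * suc m
                      ≡ α * suc (suc m) + (suc (suc m) + β + 0) * suc m
      lemma = solve-∀

    record Rebalancing (e : ℕ) : Set where
      field
        α s s′ t : ℕ
        e≡       : e ≡ α * N + s * K
        s≡       : s ≡ s′ + suc t * N
        signs≢   : a ^ α · b ^ s ≢ a ^ (α + suc t * K) · b ^ s′

    rebalance : ∀ {e α₁ s₁ α₂ s₂} → e ≡ α₁ * N + s₁ * K → e ≡ α₂ * N + s₂ * K →
                a ^ α₁ · b ^ s₁ ≢ a ^ α₂ · b ^ s₂ → Rebalancing e
    rebalance {e} {α₁} {s₁} {α₂} {s₂} e≡₁ e≡₂ signs≢ with <-cmp α₁ α₂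
    ... | tri< α₁<α₂ _ _ with consecutive-combination m {α₁} {s₁} {α₂} {s₂} (trans (sym e≡₁) e≡₂) α₁<α₂
    ...   | t , refl , s₁≡ =
      record { α = α₁ ; s = s₁ ; s′ = s₂ ; t = t ; e≡ = e≡₁ ; s≡ = s₁≡ ; signs≢ = signs≢ }
    rebalance {e} {α₁} {s₁} {α₂} {s₂} e≡₁ e≡₂ signs≢ | tri> _ _ α₂<α₁
      with consecutive-combination m {α₂} {s₂} {α₁} {s₁} (trans (sym e≡₂) e≡₁) α₂<α₁
    ...   | t , refl , s₂≡ =
      record { α = α₂ ; s = s₂ ; s′ = s₁ ; t = t ; e≡ = e≡₂ ; s≡ = s₂≡ ; signs≢ = signs≢ ∘ sym }
    rebalance {e} {α₁} {s₁} {α₂} {s₂} e≡₁ e≡₂ signs≢ | tri≈ _ refl _ =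
      contradiction (cong (λ s → a ^ α₁ · b ^ s) s₁≡s₂) signs≢
      where
      s₁≡s₂ : s₁ ≡ s₂
      s₁≡s₂ = *-cancelʳ-≡ s₁ s₂ K (+-cancelˡ-≡ (α₁ * N) _ _ (trans (sym e≡₁) e≡₂))

    cyclesSign-merge : b ≡ c → ∀ α β γ → cyclesSign α β γ ≡ a ^ α · b ^ (β + γ)
    cyclesSign-merge b≡c α β γ =
      cong (a ^ α ·_) (trans (cong (λ z → b ^ β · z ^ γ) (sym b≡c)) (sym (^-+ b β γ)))

    sssd-rebalancing : b ≡ c → ∀ {u v l} → SSSD T u v l →
                       Σ ℕ λ e → (l + toℕ u ≡ toℕ v + e) × Rebalancing e
    sssd-rebalancing b≡c {u} {v} {l} (p , q , signs≢) =
      cyclesLength α₁ β₁ γ₁ , len₁ ,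
      rebalance {α₁ = α₁} {β₁ + γ₁} {α₂} {β₂ + γ₂} refl (+-cancelˡ-≡ (toℕ v) _ _ (trans (sym len₁) len₂))
        λ eq → signs≢ (trans sign₁ (trans (cyclesSign-merge b≡c α₁ β₁ γ₁)
                      (trans eq (sym (trans sign₂ (cyclesSign-merge b≡c α₂ β₂ γ₂))))))
      where
      open CycleCount (count-cycles p) renaming (α to α₁; β to β₁; γ to γ₁; length≡ to len₁; sign≡ to sign₁)
      open CycleCount (count-cycles q) renaming (α to α₂; β to β₂; γ to γ₂; length≡ to len₂; sign≡ to sign₂)

    rebalancing⇒aᴷ≢bᴺ : ∀ {e} → Rebalancing e → a ^ K ≢ b ^ N
    rebalancing⇒aᴷ≢bᴺ r aᴷ≡bᴺ = signs≢ (begin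
      a ^ α · b ^ s                            ≡⟨ cong (λ z → a ^ α · b ^ z) s≡ ⟩
      a ^ α · b ^ (s′ + suc t * N)             ≡⟨ cong (a ^ α ·_) (^-+ b s′ _) ⟩
      a ^ α · (b ^ s′ · b ^ (suc t * N))       ≡⟨ cong (λ z → a ^ α · (b ^ s′ · z)) cycles ⟩
      a ^ α · (b ^ s′ · a ^ (suc t * K))       ≡⟨ cong (a ^ α ·_) (·-comm (b ^ s′) _) ⟩
      a ^ α · (a ^ (suc t * K) · b ^ s′)       ≡⟨ ·-assoc (a ^ α) _ _ ⟨
      (a ^ α · a ^ (suc t * K)) · b ^ s′       ≡⟨ cong (_· b ^ s′) (^-+ a α _) ⟨
      a ^ (α + suc t * K) · b ^ s′             ∎)
      where
      open Rebalancing r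
      open ≡-Reasoning
      cycles : b ^ (suc t * N) ≡ a ^ (suc t * K)
      cycles = trans (^-* b (suc t) N) (trans (cong (_^ suc t) (sym aᴷ≡bᴺ)) (sym (^-* a (suc t) K)))

    nonPowerful⇒aᴷ≢bᴺ : b ≡ c → NonPowerful T → a ^ K ≢ b ^ N
    nonPowerful⇒aᴷ≢bᴺ b≡c (_ , _ , _ , pair) = rebalancing⇒aᴷ≢bᴺ (proj₂ (proj₂ (sssd-rebalancing b≡c pair)))

    rebalancing-length : ∀ {e} → Rebalancing e → Σ ℕ λ α → Σ ℕ λ s → e ≡ α * N + (N + s) * K
    rebalancing-length r = α , s′ + t * N , trans e≡ (cong (λ z → α * N + z * K) (trans s≡ (lemma s′ t N)))
      where
      open Rebalancing r
      lemma : ∀ s t n → s + suc t * n ≡ n + (s + t * n)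
      lemma = solve-∀

    pathSign-run : ∀ c L {w t} → c + L ≤ K → T (vertex (c + L)) w ≡ just t →
                   pathSign T (run c (suc L) ++ w ∷ []) ≡ just t
    pathSign-run c zero {w} {t} _ e rewrite subst (λ i → T (vertex i) w ≡ just t) (+-identityʳ c) e =
      cong just (·-identityʳ t)
    pathSign-run c (suc L) {w} {t} c+L≤K e
      rewrite forward-pos c (≤-trans (subst (suc c ≤_) (sym (+-suc c L)) (s≤s (m≤m+n c L))) c+L≤K)
            | pathSign-run (suc c) L (subst (_≤ K) (+-suc c L) c+L≤K)
                                     (subst (λ i → T (vertex i) w ≡ just t) (+-suc c L) e)
      = refl

    cycle-B : cycleSign T (C₁ N) ≡ just b
    cycle-B = subst (λ L → cycleSign T L ≡ just b) (sym C₁≡run)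
                    (pathSign-run 0 m (n≤1+n m) (proj₂ (arc D₂-B)))

    cycle-C : cycleSign T (C₂ N) ≡ just c
    cycle-C = subst (λ L → cycleSign T L ≡ just c) (sym C₂≡run)
                    (pathSign-run 1 m ≤-refl (proj₂ (arc D₂-C)))

    at-vertices : ∀ {xf vf : Fin N} {p} → SSSD T (vertex (toℕ xf)) (vertex (toℕ vf)) p → SSSD T xf vf p
    at-vertices {xf} {vf} = subst₂ (λ x v → SSSD T x v _) (vertex-toℕ xf) (vertex-toℕ vf)

    sssd-swap-B-C : b ≢ c → ∀ {x v} α β p → p + x ≡ v + cyclesLength α (suc β) 0 →
                   ReachBy x v α (suc β) 0 → ReachBy x v α β 1 → SSSD T (vertex x) (vertex v) p
    sssd-swap-B-C b≢c α β p len r r′ =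
      sssd-from p len r (reach-cast (sym (swap-B-C-length α β)) refl r′) (swap-B-C b≢c α β)

    sssd-b≢c-same : b ≢ c → ∀ {x v d K₀} → x ≤ K → v ≤ K → x ≡ v + d → Swappable K₀ d →
                    SSSD T (vertex x) (vertex v) ((K₀ + 1) * K + 2)
    sssd-b≢c-same b≢c {d = d} x≤K v≤K x≡v+d (short B refl) =
      sssd-swap-B-C b≢c (suc (suc d)) B _ (same-length x≡v+d (length d B m))
        (reach-A x≤K v≤K (suc d) (suc B)) (reach-AC x≤K v≤K (suc d) B)
      where
      length : ∀ d B m → (suc (suc d) + B + 1) * suc m + 2 + d
                       ≡ suc (suc d) * suc (suc m) + (suc B + 0) * suc m
      length = solve-∀
    sssd-b≢c-same b≢c {K₀ = K₀} x≤K v≤K x≡v+m (at-m refl) =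
      sssd-swap-B-C b≢c 1 K₀ _ (same-length x≡v+m (length K₀ m))
        (reach-A x≤K v≤K 0 (suc K₀)) (reach-AC x≤K v≤K 0 K₀)
      where
      length : ∀ K₀ m → (K₀ + 1) * suc m + 2 + m ≡ 1 * suc (suc m) + (suc K₀ + 0) * suc m
      length = solve-∀
    sssd-b≢c-same b≢c x≤K v≤K x≡v+K (at-K K₁ refl refl) =
      sssd-swap-B-C b≢c 2 K₁ _ (same-length x≡v+K (length K₁ m))
        (reach-A x≤K v≤K 1 (suc K₁)) (reach-AC x≤K v≤K 1 K₁)
      where
      length : ∀ K₁ m → (suc K₁ + 1) * suc m + 2 + suc m ≡ 2 * suc (suc m) + (suc K₁ + 0) * suc m
      length = solve-∀

    sssd-b≢c-wrap : b ≢ c → ∀ {x v d K₀} → x ≤ K → v ≤ K → x + N ≡ v + d → Swappable K₀ d →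
                    SSSD T (vertex x) (vertex v) ((K₀ + 1) * K + 2)
    sssd-b≢c-wrap b≢c {d = d} x≤K v≤K x+N≡v+d (short B refl) =
      sssd-swap-B-C b≢c (suc d) B _ (wrap-length x+N≡v+d (length d B m))
        (reach-A x≤K v≤K d (suc B)) (reach-AC x≤K v≤K d B)
      where
      length : ∀ d B m → (suc (suc d) + B + 1) * suc m + 2 + d
                       ≡ suc d * suc (suc m) + (suc B + 0) * suc m + suc (suc m)
      length = solve-∀
    sssd-b≢c-wrap b≢c {x} {v} {K₀ = K₀} x≤K v≤K x+N≡v+m (at-m refl) =
      sssd-swap-B-C b≢c 0 K₀ _ (wrap-length x+N≡v+m (length K₀ m))
        (reach-low x≤m v≤K 0 K₀) (reach-BC x≤m (subst (1 ≤_) (sym v≡2+x) (s≤s z≤n)) v≤K K₀)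
      where
      length : ∀ K₀ m → (K₀ + 1) * suc m + 2 + m ≡ 0 * suc (suc m) + (suc K₀ + 0) * suc m + suc (suc m)
      length = solve-∀
      v≡2+x : v ≡ suc (suc x)
      v≡2+x = +-cancelʳ-≡ m v (suc (suc x))
                (trans (sym x+N≡v+m) (trans (+-suc x (suc m)) (cong suc (+-suc x m))))
      x≤m : x ≤ m
      x≤m = ≤-trans (n≤1+n x) (s≤s⁻¹ (subst (_≤ K) v≡2+x v≤K))
    sssd-b≢c-wrap b≢c x≤K v≤K x+N≡v+K (at-K K₁ refl refl) =
      sssd-swap-B-C b≢c 1 K₁ _ (wrap-length x+N≡v+K (length K₁ m))
        (reach-A x≤K v≤K 0 (suc K₁)) (reach-AC x≤K v≤K 0 K₁)
      where
      length : ∀ K₁ m → (suc K₁ + 1) * suc m + 2 + suc m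
                      ≡ 1 * suc (suc m) + (suc K₁ + 0) * suc m + suc (suc m)
      length = solve-∀

    sssd-b≢c : b ≢ c → ∀ {x v d K₀} → x ≤ K → v ≤ K → Offset x v d → Swappable K₀ d →
               SSSD T (vertex x) (vertex v) ((K₀ + 1) * K + 2)
    sssd-b≢c b≢c x≤K v≤K (same x≡v+d) = sssd-b≢c-same b≢c x≤K v≤K x≡v+d
    sssd-b≢c b≢c x≤K v≤K (wrap x+N≡v+d) = sssd-b≢c-wrap b≢c x≤K v≤K x+N≡v+d

    sssd-trade-A-B : a ^ K ≢ b ^ N → ∀ {x v} α β p → p + x ≡ v + cyclesLength (K + α) β 0 →
                   ReachBy x v (K + α) β 0 → ReachBy x v α (N + β) 0 → SSSD T (vertex x) (vertex v) p
    sssd-trade-A-B aᴷ≢bᴺ α β p len r r′ =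
      sssd-from p len r (reach-cast (sym (trade-A-B-length α β)) refl r′) (trade-A-B aᴷ≢bᴺ α β)

    sssd-b≡c : b ≡ c → a ^ K ≢ b ^ N → ∀ {x v d} B → x ≤ K → v ≤ K → d ≤ K → Offset x v d →
               SSSD T (vertex x) (vertex v) ((N + (d + B)) * K)
    sssd-b≡c b≡c aᴷ≢bᴺ {d = suc r} B x≤K v≤K _ (same x≡v+d) =
      sssd-trade-A-B aᴷ≢bᴺ (suc r) B _ (same-length x≡v+d (length r B m))
        (reach-A x≤K v≤K (m + suc r) B) (reach-A x≤K v≤K r (N + B))
      where
      length : ∀ r B m → (suc (suc m) + (suc r + B)) * suc m + suc r
                       ≡ (suc m + suc r) * suc (suc m) + (B + 0) * suc m
      length = solve-∀
    sssd-b≡c b≡c aᴷ≢bᴺ {x} {d = zero} B x≤K v≤K _ (same x≡v+0) with x ≤? m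
    ... | yes x≤m =
      sssd-trade-A-B aᴷ≢bᴺ 0 B _ (same-length x≡v+0 (length B m))
        (reach-A x≤K v≤K (m + 0) B) (reach-low x≤m v≤K 0 (K + B))
      where
      length : ∀ B m → (suc (suc m) + (0 + B)) * suc m + 0 ≡ (suc m + 0) * suc (suc m) + (B + 0) * suc m
      length = solve-∀
    ... | no x≰m with ≤-antisym x≤K (≰⇒> x≰m)
    ...   | refl with trans (sym (+-identityʳ _)) (sym x≡v+0)
    ...     | refl =
      sssd-trade-A-B aᴷ≢bᴺ 0 B _ (same-length {K} {K} {0} x≡v+0 (length B m))
        (reach-A x≤K v≤K (m + 0) B)
        (reach-cast (cong (λ β → 0 * N + β * K) (sym (+-identityʳ (N + B))))
                    (cong (pos ·_) (trans (cong (_^ (N + B)) (sym b≡c)) (sym (·-identityʳ _))))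
                    (reach-C (K + B)))
      where
      length : ∀ B m → (suc (suc m) + (0 + B)) * suc m + 0 ≡ (suc m + 0) * suc (suc m) + (B + 0) * suc m
      length = solve-∀
    sssd-b≡c b≡c aᴷ≢bᴺ {d = suc r} B x≤K v≤K d≤K (wrap x+N≡v+d) =
      sssd-trade-A-B aᴷ≢bᴺ r B _ (wrap-length x+N≡v+d (length r B m))
        (reach-A x≤K v≤K (m + r) B) (reach-low (wrap⇒≤m x+N≡v+d v≤K d≤K) v≤K r (K + B))
      where
      length : ∀ r B m → (suc (suc m) + (suc r + B)) * suc m + suc r
                       ≡ (suc m + r) * suc (suc m) + (B + 0) * suc m + suc (suc m)
      length = solve-∀
    sssd-b≡c b≡c aᴷ≢bᴺ {x} {v} {d = zero} B x≤K v≤K _ (wrap x+N≡v+0) =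
      contradiction (subst (_≤ K) (trans (sym (+-identityʳ v)) (sym x+N≡v+0)) v≤K) (<⇒≱ (m≤n+m N x))

    covers-b≢c : b ≢ c → ∀ {K₀ k} → K₀ + k ≡ K → ∀ X → ∣ X ∣ ≡ suc k → Covers T X ((K₀ + 1) * K + 2)
    covers-b≢c b≢c {K₀} {k} K₀+k X ∣X∣ vf
      with pigeonhole X (λ t → vertex (toℕ vf + (K₀ + K) + t)) k (≤-reflexive (sym ∣X∣))
    ... | xf , xf∈X , avoids with offset (toℕ≤K xf) (toℕ≤K vf)
    ...   | d , d≤K , off with swappable-or-excluded K₀+k d≤K
    ...     | inj₁ case = xf , xf∈X , at-vertices (sssd-b≢c b≢c (toℕ≤K xf) (toℕ≤K vf) off case)
    ...     | inj₂ excluded = contradiction excluded (not-excluded off avoids)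

    covers-b≡c : b ≡ c → a ^ K ≢ b ^ N → ∀ {K₀ k} → K₀ + k ≡ K →
                 ∀ X → ∣ X ∣ ≡ suc k → Covers T X ((N + K₀) * K)
    covers-b≡c b≡c aᴷ≢bᴺ {K₀} {k} K₀+k X ∣X∣ vf
      with pigeonhole X (λ t → vertex (toℕ vf + suc K₀ + t)) k (≤-reflexive (sym ∣X∣))
    ... | xf , xf∈X , avoids with offset (toℕ≤K xf) (toℕ≤K vf)
    ...   | d , d≤K , off with within-or-excluded K₀+k d≤K
    ...     | inj₂ excluded = contradiction excluded (not-excluded off avoids)
    ...     | inj₁ d≤K₀ with B , refl ← m≤n⇒∃[o]m+o≡n d≤K₀ =
      xf , xf∈X , at-vertices (sssd-b≡c b≡c aᴷ≢bᴺ B (toℕ≤K xf) (toℕ≤K vf) d≤K off)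

    -- The paper's {1} ∪ {n - k + 2, …, n} when K₀ = n - k.
    X₀ : ℕ → Subset N
    X₀ K₀ = inside ∷ atLeast K₀

    X₀-not-covered : b ≡ c → ∀ {K₀} → K₀ ≤ K → ∀ q → q < (N + K₀) * K → ¬ Covers T (X₀ K₀) q
    X₀-not-covered b≡c {K₀} K₀≤K q q<bound covered with covered (vertex (suc (q % K)))
    ... | xf , xf∈X₀ , pair with sssd-rebalancing b≡c pair
    ...   | e , len , r with rebalancing-length r
    ...     | α , s , refl = <⇒≱ q<bound (begin
      (N + K₀) * K       ≤⟨ *-monoˡ-≤ K (N+K₀≤A xf xf∈X₀ len′) ⟩
      (q / K) * K        ≤⟨ m≤n+m _ (q % K) ⟩
      q % K + (q / K) * K ≡⟨ m≡m%n+[m/n]*n q K ⟨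
      q                  ∎)
      where
      open ≤-Reasoning
      len′ : q % K + (q / K) * K + toℕ xf ≡ suc (q % K) + (α * N + (N + s) * K)
      len′ = trans (cong (_+ toℕ xf) (sym (m≡m%n+[m/n]*n q K)))
                   (trans len (cong (_+ _) (toℕ-vertex (s≤s (m%n<n q K)))))
      N+K₀≤A : ∀ xf → xf ∈ X₀ K₀ → q % K + (q / K) * K + toℕ xf ≡ suc (q % K) + (α * N + (N + s) * K) →
               N + K₀ ≤ q / K
      N+K₀≤A Fin.zero _ eq =
        ≤-trans (+-monoʳ-≤ N K₀≤K) (quotient-bound-zero {q % K} {q / K} {α} {s} eq)
      N+K₀≤A (Fin.suc j) (there j∈) eq =
        ≤-trans (+-monoʳ-≤ N (∈atLeast⇒≤ K₀ j∈)) (quotient-bound-suc {q % K} {q / K} {toℕ j} {α} {s} eq (toℕ<n j))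

  module Bounds (S : SignedDigraph N) (S-arcs : SameDigraph (Underlying S) (D₂ N)) where

    potential : ℕ → Sign
    potential zero = pos
    potential (suc i) = potential i · fromMaybe pos (S (vertex i) (vertex (suc i)))

    θ : Fin N → Sign
    θ u = potential (toℕ u)

    T : SignedDigraph N
    T = switch θ S

    T-arcs : SameDigraph (Underlying T) (D₂ N)
    T-arcs u v = mk⇔ (Equivalence.to (S-arcs u v) ∘ Equivalence.to (switch-underlying θ S u v))
                     (Equivalence.from (switch-underlying θ S u v) ∘ Equivalence.from (S-arcs u v))

    T-forward-pos : ∀ i → i < K → T (vertex i) (vertex (suc i)) ≡ just pos
    T-forward-pos i i<K with Is-just⇒≡just (Equivalence.from (S-arcs _ _) (D₂-forward i<K))
    ... | s , e = begin
      T (vertex i) (vertex (suc i))                   ≡⟨ cong (Maybe.map _) e ⟩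
      just (θ (vertex i) · (s · θ (vertex (suc i))))  ≡⟨ cong₂ (λ p q → just (p · (s · q))) θᵢ θᵢ₊₁ ⟩
      just (Pᵢ · (s · (Pᵢ · s)))                      ≡⟨ cong (λ x → just (Pᵢ · x)) (·-exchange s Pᵢ s) ⟩
      just (Pᵢ · (Pᵢ · (s · s)))                      ≡⟨ cong just (·-involutiveˡ Pᵢ (s · s)) ⟩
      just (s · s)                                    ≡⟨ cong just (·-selfInverse s) ⟩
      just pos                                        ∎
      where
      open ≡-Reasoning
      Pᵢ = potential i
      θᵢ : θ (vertex i) ≡ potential i
      θᵢ = cong potential (toℕ-vertex (m≤n⇒m≤1+n i<K))
      θᵢ₊₁ : θ (vertex (suc i)) ≡ potential i · s
      θᵢ₊₁ = trans (cong potential (toℕ-vertex (s≤s i<K))) (cong (λ x → potential i · fromMaybe pos x) e)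

    open Positive T T-arcs T-forward-pos

    cycle-signs : ∀ {s₁ s₂} → cycleSign S (C₁ N) ≡ just s₁ → cycleSign S (C₂ N) ≡ just s₂ → s₁ ≡ b × s₂ ≡ c
    cycle-signs C₁≡ C₂≡ = just-injective (trans (sym C₁≡) (trans (sym (cycleSign-switch θ S (C₁ N))) cycle-B))
                        , just-injective (trans (sym C₂≡) (trans (sym (cycleSign-switch θ S (C₂ N))) cycle-C))

    module _ {k} (k≤K : k ≤ K) where

      K₀ : ℕ
      K₀ = K ∸ k

      K₀+k : K₀ + k ≡ K
      K₀+k = m∸n+n≡m k≤K

      ∣X₀∣ : ∣ X₀ K₀ ∣ ≡ suc k
      ∣X₀∣ = cong suc (trans (∣atLeast∣ K K₀) (m∸[m∸n]≡n k≤K))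

      upperBase-≢ : ∀ {s₁ s₂} → cycleSign S (C₁ N) ≡ just s₁ → cycleSign S (C₂ N) ≡ just s₂ → s₁ ≢ s₂ →
                    Σ ℕ λ L → IsUpperBase S (suc k) L × L ≤ (K₀ + 1) * K + 2
      upperBase-≢ C₁≡ C₂≡ s₁≢s₂ with refl , refl ← cycle-signs C₁≡ C₂≡ =
        upperBase-≤ S _ (suc k) (X₀ K₀ , ∣X₀∣) λ X ∣X∣ →
          Equivalence.from (covers-switch θ S X _) (covers-b≢c s₁≢s₂ K₀+k X ∣X∣)

      upperBase-≡ : NonPowerful S → ∀ {s₁ s₂} → cycleSign S (C₁ N) ≡ just s₁ → cycleSign S (C₂ N) ≡ just s₂ →
                    s₁ ≡ s₂ → IsUpperBase S (suc k) ((N + K₀) * K)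
      upperBase-≡ nonPowerful C₁≡ C₂≡ s₁≡s₂ with refl , refl ← cycle-signs C₁≡ C₂≡ =
        IsUpperBase-attained S (suc k) _ (X₀ K₀ , ∣X₀∣ , covered (X₀ K₀) ∣X₀∣ , not-covered′) covered
        where
        covered : ∀ X → ∣ X ∣ ≡ suc k → Covers S X ((N + K₀) * K)
        covered X ∣X∣ = Equivalence.from (covers-switch θ S X _)
          (covers-b≡c s₁≡s₂ (nonPowerful⇒aᴷ≢bᴺ s₁≡s₂ (nonPowerful-switch θ S nonPowerful)) K₀+k X ∣X∣)
        not-covered′ : ∀ q → q < (N + K₀) * K → ¬ Covers S (X₀ K₀) q
        not-covered′ q q<L =
          X₀-not-covered s₁≡s₂ (m∸n≤m K k) q q<L ∘ Equivalence.to (covers-switch θ S (X₀ K₀) q)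

walkSign-order-1 : ∀ (S : SignedDigraph 1) {u v l} (p : Walk S u v l) →
                   walkSign p ≡ fromMaybe pos (S Fin.zero Fin.zero) ^ l
walkSign-order-1 S [] = refl
walkSign-order-1 S (_∷_ {u = Fin.zero} {w = Fin.zero} e p) =
  cong₂ _·_ (sym (cong (fromMaybe pos) e)) (walkSign-order-1 S p)

order-1-powerful : (S : SignedDigraph 1) → ¬ NonPowerful S
order-1-powerful S (_ , _ , _ , p , q , signs≢) =
  signs≢ (trans (walkSign-order-1 S p) (sym (walkSign-order-1 S q)))

theorem3p5 : (n : ℕ) (S : SignedDigraph n) →
    SameDigraph (Underlying S) (D₂ n) → Primitive S → NonPowerful S →
    (k : ℕ) → 1 ≤ k → k ≤ n →
    (∀ s₁ s₂ → cycleSign S (C₁ n) ≡ just s₁ → cycleSign S (C₂ n) ≡ just s₂ → s₁ ≢ s₂ →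
      Σ ℕ λ b → IsUpperBase S k b × b ≤ (n ∸ k + 1) * (n ∸ 1) + 2)
    × (∀ s₁ s₂ → cycleSign S (C₁ n) ≡ just s₁ → cycleSign S (C₂ n) ≡ just s₂ → s₁ ≡ s₂ →
      IsUpperBase S k ((2 * n ∸ k) * (n ∸ 1)))
theorem3p5 zero S _ _ _ k 1≤k k≤0 = contradiction (≤-trans 1≤k k≤0) λ ()
theorem3p5 (suc zero) S _ _ nonPowerful _ _ _ = contradiction nonPowerful (order-1-powerful S)
theorem3p5 (suc (suc m)) S S-arcs _ nonPowerful (suc k) _ 1+k≤N =
  (λ _ _ → upperBase-≢ k≤K) ,
  (λ _ _ C₁≡ C₂≡ s₁≡s₂ →
    subst (IsUpperBase S (suc k)) (cong (_* K) (sym 2N∸k)) (upperBase-≡ k≤K nonPowerful C₁≡ C₂≡ s₁≡s₂))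
  where
  open OnD₂ m
  open Bounds S S-arcs
  k≤K : k ≤ K
  k≤K = s≤s⁻¹ 1+k≤N
  2N∸k : 2 * N ∸ suc k ≡ N + (K ∸ k)
  2N∸k = trans (cong (λ z → N + z ∸ suc k) (+-identityʳ N)) (+-∸-assoc N 1+k≤N)
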